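{- Let $S$ be (the edge set of) a spanning tree of a rooted map $\mathcal M_\bullet=(\mathcal M,b_\bullet)$, and let $w$ be the associated double occurrence word. Then $S$, rooted at the vertex containing $b_\bullet$, has the Trémaux property if and only if no edge $f$ has, in $\vec\Lambda(w)$, both an in-neighbor in $S$ and an out-neighbor in $S$. Equivalently, $S$ has the Trémaux property if and only if $w$ does not contain the pattern $e_1\,f\,e_1\,e_2\,f\,e_2$ (as a subsequence) with $e_1,e_2\in S$.
   Context: A map is a triple $\mathcal M=(B,\sigma,\alpha)$ with $B$ a finite set (of flags), $\sigma,\alpha\in\mathrm{Sym}(B)$, $\alpha$ a fixed-point-free involution, $\langle\sigma,\alpha\rangle$ transitive on $B$; permutations compose as functions. Edges are cycles of $\alpha$, vertices cycles of $\sigma$; $\underline b=\{b,\alpha(b)\}$. $G(\mathcal M)$ is the graph with these vertices and edges, edge $e$ incident to vertex $v$ iff $e\cap v\ne\emptyset$. A rooted map is $(\mathcal M,b_\bullet)$ with $b_\bullet\in B$. For a spanning tree $S$ of $G(\mathcal M)$, its tour $\tau$ (defined by $\tau(b)=\sigma\alpha(b)$ if $\underline b\in S$, $\tau(b)=\sigma(b)$ otherwise) is a cyclic permutation of $B$; the associated double occurrence word is $w=\underline{b_\bullet}\,\underline{\tau(b_\bullet)}\,\underline{\tau^2(b_\bullet)}\cdots\underline{\tau^{|B|-1}(b_\bullet)}$, a word over the edges in which each edge occurs exactly twice. $\vec\Lambda(w)$ is the directed graph on the edges with an arc $e\to f$ whenever $e\,f\,e\,f$ is a subsequence of $w$. A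 rooted spanning tree has the Trémaux property if for every edge of $G(\mathcal M)$ its two endpoints lie on a common root-to-leaf path of the tree (one is an ancestor of the other). -}

module Defs where

open import Data.Nat using (ℕ; zero; suc; _<_)
open import Data.Fin using (Fin; toℕ)
open import Data.Fin.Permutation using (Permutation′; _⟨$⟩ʳ_; _⟨$⟩ˡ_)
open import Data.Bool using (Bool; true; false; if_then_else_)
open import Data.List using (List; []; _∷_; map; foldr)
open import Data.List.Relation.Unary.All using (All)
open import Data.List.Relation.Unary.Any using (Any)
open import Data.Unit using (⊤)
open import Data.Empty using (⊥)
open import Data.List.Relation.Unary.AllPairs using (AllPairs)
open import Data.Product using (Σ; ∃; ∃-syntax; _×_; _,_)
open import Data.Sum using (_⊎_)
open import Relation.Binary.PropositionalEquality using (_≡_; _≢_)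
open import Relation.Nullary using (¬_)
open import Function using (_∘_)

iter : ∀ {A : Set} → (A → A) → ℕ → A → A
iter f zero    x = x
iter f (suc k) x = f (iter f k x)

-- Generators of the group ⟨σ, α⟩ (α is an involution, so α⁻¹ = α)
data Gen : Set where
  gσ gσ⁻¹ gα : Gen

applyGen : ∀ {n} → Permutation′ n → Permutation′ n → Gen → Fin n → Fin n
applyGen σ α gσ   b = σ ⟨$⟩ʳ b
applyGen σ α gσ⁻¹ b = σ ⟨$⟩ˡ b
applyGen σ α gα   b = α ⟨$⟩ʳ b

-- apply a word in the generators (rightmost letter acts first)
applyWord : ∀ {n} → Permutation′ n → Permutation′ n → List Gen → Fin n → Fin n
applyWord σ α ws b = foldr (applyGen σ α) b ws

record Map (n : ℕ) : Set where
  field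
    σ : Permutation′ n
    α : Permutation′ n
    α-invol     : ∀ b → α ⟨$⟩ʳ (α ⟨$⟩ʳ b) ≡ b
    α-fpf       : ∀ b → α ⟨$⟩ʳ b ≢ b
    transitive  : ∀ b c → ∃[ ws ] applyWord σ α ws b ≡ c

module MapNotions {n : ℕ} (M : Map n) where
  open Map M

  σf αf : Fin n → Fin n
  σf b = σ ⟨$⟩ʳ b
  αf b = α ⟨$⟩ʳ b

  SameVertex : Fin n → Fin n → Set
  SameVertex b c = ∃[ k ] iter σf k b ≡ c

  SameEdge : Fin n → Fin n → Set
  SameEdge b c = (c ≡ b) ⊎ (c ≡ αf b)

  -- A flag b ∈ S with S ⊆ B closed under α represents the edge {b, α b}
  -- traversed from the vertex containing b to the vertex containing α b.
  module InSubgraph (S : Fin n → Bool) where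

    InS : Fin n → Set
    InS b = S b ≡ true

    -- consecutive traversals fit together: the walk b₁ … b_k goes
    -- through vertices v(b₁), v(α b₁) = v(b₂), …, v(α b_k)
    Chain : List (Fin n) → Set
    Chain []            = ⊤
    Chain (b ∷ [])      = ⊤
    Chain (b ∷ c ∷ bs)  = SameVertex (αf b) c × Chain (c ∷ bs)

    lastEnd : Fin n → List (Fin n) → Fin n
    lastEnd x []       = x
    lastEnd x (b ∷ bs) = lastEnd (αf b) bs

    Walk : Fin n → Fin n → List (Fin n) → Set
    Walk x y []       = SameVertex x y
    Walk x y (b ∷ bs) = SameVertex x b × All InS (b ∷ bs) × Chain (b ∷ bs)
                        × SameVertex (lastEnd x (b ∷ bs)) y

    visited : Fin n → List (Fin n) → List (Fin n)
    visited x bs = x ∷ map αf bs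

    Path : Fin n → Fin n → List (Fin n) → Set
    Path x y bs = Walk x y bs × AllPairs (λ u v → ¬ SameVertex u v) (visited x bs)

    -- a cycle: a nonempty closed walk b₁ … b_k in S with pairwise distinct
    -- vertices v(b₁), …, v(b_k) and pairwise distinct edges
    -- (loops are cycles of length 1, parallel edges give cycles of length 2)
    Cycle : List (Fin n) → Set
    Cycle []       = ⊥
    Cycle (b ∷ bs) = Walk b b (b ∷ bs)
                   × AllPairs (λ u v → ¬ SameVertex u v) (b ∷ bs)
                   × AllPairs (λ u v → ¬ SameEdge u v) (b ∷ bs)

    IsSpanningTree : Set
    IsSpanningTree =
        (∀ b → S (αf b) ≡ S b)
      × (∀ x y → ∃[ bs ] Walk x y bs)
      × (∀ bs → ¬ Cycle bs)

    Ancestor : Fin n → Fin n → Fin n → Set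
    Ancestor r u v = ∃[ bs ] Path r v bs × Any (SameVertex u) (visited r bs)

    Tremaux : Fin n → Set
    Tremaux r = ∀ b → Ancestor r b (αf b) ⊎ Ancestor r (αf b) b

    tour : Fin n → Fin n
    tour b = if S b then σf (αf b) else σf b

    -- the double occurrence word: its i-th letter (0 ≤ i < n) is the edge of
    -- tour^i(r), represented by the flag tour^i(r)
    letter : Fin n → ℕ → Fin n
    letter r i = iter tour i r

    At : Fin n → ℕ → Fin n → Set
    At r i e = SameEdge e (letter r i)

    -- arc e → f in Λ⃗(w): e f e f is a subsequence of w
    Arc : Fin n → Fin n → Fin n → Set
    Arc r e f = ∃[ i ] ∃[ j ] ∃[ k ] ∃[ l ]
      (i < j × j < k × k < l × l < n
       × At r i e × At r j f × At r k e × At r l f)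

    HasInOutS : Fin n → Set
    HasInOutS r = ∃[ f ] ∃[ e₁ ] ∃[ e₂ ] (InS e₁ × InS e₂ × Arc r e₁ f × Arc r f e₂)

    HasPattern : Fin n → Set
    HasPattern r = ∃[ e₁ ] ∃[ f ] ∃[ e₂ ] ∃[ i₁ ] ∃[ i₂ ] ∃[ i₃ ] ∃[ i₄ ] ∃[ i₅ ] ∃[ i₆ ]
      (InS e₁ × InS e₂
       × i₁ < i₂ × i₂ < i₃ × i₃ < i₄ × i₄ < i₅ × i₅ < i₆ × i₆ < n
       × At r i₁ e₁ × At r i₂ f × At r i₃ e₁
       × At r i₄ e₂ × At r i₅ f × At r i₆ e₂)

-- Follow the tour w and keep a stack of tree flags: a flag of S is pushed, unless it is
-- the reverse of the top flag, which it pops. The stack is always the path of S from the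
-- root to the current vertex, every such path occurs, and the tour is one cycle through all
-- n flags; hence u is an ancestor of v iff the stack at u is a suffix of the stack at v, and
-- a tree edge lies on the stack exactly between its two occurrences in w. An arc e₁ → f
-- puts the first occurrence of f inside the interval of e₁ and the second after it, an arc
-- f → e₂ puts the second inside the interval of e₂ and the first before it; so if one
-- endpoint of f is an ancestor of the other, one of the two arcs is missing. If neither is,
-- the stacks at the two occurrences of f branch off at tree edges e₁ ≠ e₂, and e₁ is popped
-- and e₂ pushed between them, which yields the pattern e₁ f e₁ e₂ f e₂.

module Submission where

open import Defs
open import Data.Bool using (Bool; true; false; if_then_else_)
open import Data.Fin using (Fin; toℕ; fromℕ<)
import Data.Fin.Properties as Fin
open import Data.Fin.Permutation using (_⟨$⟩ˡ_; inverseˡ)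
open import Data.List using (List; []; _∷_; _∷ʳ_; _++_; map; length; reverse)
import Data.List.Properties as List
open import Data.List.Relation.Unary.All using (All; []; _∷_)
import Data.List.Relation.Unary.All as All
import Data.List.Relation.Unary.All.Properties as All
open import Data.List.Relation.Unary.AllPairs using (AllPairs; []; _∷_)
import Data.List.Relation.Unary.AllPairs.Properties as AllPairs
open import Data.List.Relation.Unary.Any using (Any; here; there)
import Data.List.Relation.Unary.Any.Properties as Any
open import Data.Nat using (ℕ; zero; suc; _+_; _*_; _∸_; _≤_; _<_; z≤n; NonZero; >-nonZero; >-nonZero⁻¹)
open import Data.Nat.DivMod using (_%_; _/_; m%n<n; m≡m%n+[m/n]*n)
open import Data.Nat.Properties
open import Data.Product using (∃-syntax; _×_; _,_; proj₁; proj₂)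
open import Data.Sum using (_⊎_; inj₁; inj₂; swap)
open import Data.Unit using (⊤; tt)
open import Function using (_∘_)
open import Function.Bundles using (_⇔_; mk⇔)
open import Function.Definitions using (Injective)
open import Relation.Binary.Definitions using (DecidableEquality; Decidable; tri<; tri≈; tri>)
open import Relation.Binary.PropositionalEquality
open import Relation.Nullary using (¬_; Dec; yes; no; contradiction)
open import Relation.Nullary.Decidable using (¬?; decidable-stable)

module _ {A : Set} {f : A → A} where

  iter-+ : ∀ m n x → iter f (m + n) x ≡ iter f m (iter f n x)
  iter-+ zero    n x = refl
  iter-+ (suc m) n x = cong f (iter-+ m n x)

  iter-*-fixed : ∀ {q x} → iter f q x ≡ x → ∀ k → iter f (k * q) x ≡ x
  iter-*-fixed         fix zero    = refl
  iter-*-fixed {q} {x} fix (suc k) = begin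
    iter f (q + k * q) x        ≡⟨ iter-+ q (k * q) x ⟩
    iter f q (iter f (k * q) x) ≡⟨ cong (iter f q) (iter-*-fixed fix k) ⟩
    iter f q x                  ≡⟨ fix ⟩
    x                           ∎
    where open ≡-Reasoning

  module _ (f-injective : Injective _≡_ _≡_ f) where

    iter-injective : ∀ k → Injective _≡_ _≡_ (iter f k)
    iter-injective zero    eq = eq
    iter-injective (suc k) eq = iter-injective k (f-injective eq)

    iter-∸ : ∀ {i j} x → i ≤ j → iter f i x ≡ iter f j x → iter f (j ∸ i) x ≡ x
    iter-∸ {i} {j} x i≤j eq = sym (iter-injective i (begin
      iter f i x                 ≡⟨ eq ⟩
      iter f j x                 ≡⟨ cong (λ k → iter f k x) (m+[n∸m]≡n i≤j) ⟨
      iter f (i + (j ∸ i)) x     ≡⟨ iter-+ i (j ∸ i) x ⟩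
      iter f i (iter f (j ∸ i) x) ∎))
      where open ≡-Reasoning

module _ {n} {f : Fin n → Fin n} (f-injective : Injective _≡_ _≡_ f) where

  iter-returns : ∀ x → ∃[ q ] (0 < q × q ≤ n × iter f q x ≡ x)
  iter-returns x with Fin.pigeonhole (n<1+n n) (λ i → iter f (toℕ i) x)
  ... | i , j , i<j , eq =
    toℕ j ∸ toℕ i , m<n⇒0<n∸m i<j , ≤-trans (m∸n≤m (toℕ j) (toℕ i)) (Fin.toℕ≤pred[n] j)
    , iter-∸ f-injective x (<⇒≤ i<j) eq

  iter-reverse : ∀ {k x y} → iter f k x ≡ y → ∃[ k′ ] iter f k′ y ≡ x
  iter-reverse {k} {x} refl with iter-returns x
  ... | q , 0<q , _ , fix = k * q ∸ k , (begin
    iter f (k * q ∸ k) (iter f k x) ≡⟨ iter-+ (k * q ∸ k) k x ⟨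
    iter f (k * q ∸ k + k) x        ≡⟨ cong (λ m → iter f m x) (m∸n+n≡m (m≤m*n k q)) ⟩
    iter f (k * q) x                ≡⟨ iter-*-fixed fix k ⟩
    x                               ∎)
    where open ≡-Reasoning
          instance _ = >-nonZero 0<q

module _ {A : Set} {g : ℕ → A} {d} (periodic : ∀ j → g (j + d) ≡ g j) where

  periodic-+* : ∀ j k → g (j + k * d) ≡ g j
  periodic-+* j zero    = cong g (+-identityʳ j)
  periodic-+* j (suc k) = begin
    g (j + (d + k * d)) ≡⟨ cong g (+-assoc j d (k * d)) ⟨
    g (j + d + k * d)   ≡⟨ periodic-+* (j + d) k ⟩
    g (j + d)           ≡⟨ periodic j ⟩
    g j                 ∎
    where open ≡-Reasoning

  periodic-% : .{{_ : NonZero d}} → ∀ m → g m ≡ g (m % d)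
  periodic-% m = trans (cong g (m≡m%n+[m/n]*n m d)) (periodic-+* (m % d) (m / d))

first-change : (P : ℕ → Set) → (∀ k → Dec (P k)) → ∀ {m m′} → m ≤ m′ → P m → ¬ P m′
             → ∃[ k ] (m ≤ k × k < m′ × P k × ¬ P (suc k))
first-change P P? {m′ = zero}   z≤n   Pm ¬Pm′ = contradiction Pm ¬Pm′
first-change P P? {m′ = suc m′} m≤1+m′ Pm ¬P1+m′ with m≤n⇒m<n∨m≡n m≤1+m′
... | inj₂ refl = contradiction Pm ¬P1+m′
... | inj₁ m<1+m′ with P? m′
...   | yes Pm′ = m′ , <⇒≤pred m<1+m′ , n<1+n m′ , Pm′ , ¬P1+m′
...   | no ¬Pm′ with first-change P P? (<⇒≤pred m<1+m′) Pm ¬Pm′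
...     | k , m≤k , k<m′ , Pk , ¬P1+k = k , m≤k , m<n⇒m<1+n k<m′ , Pk , ¬P1+k

module _ {A : Set} where

  infix 4 _≼_

  _≼_ : List A → List A → Set
  xs ≼ ys = ∃[ ds ] ys ≡ ds ++ xs

  ≼-refl : ∀ {xs} → xs ≼ xs
  ≼-refl = [] , refl

  ≼-there : ∀ {xs ys} y → xs ≼ ys → xs ≼ y ∷ ys
  ≼-there y (ds , refl) = y ∷ ds , refl

  ≼-trans : ∀ {xs ys zs} → xs ≼ ys → ys ≼ zs → xs ≼ zs
  ≼-trans {xs} (ds , refl) (es , refl) = es ++ ds , sym (List.++-assoc es ds xs)

  ∷⋠[] : ∀ {x xs} → ¬ (x ∷ xs ≼ [])
  ∷⋠[] ([] , ())
  ∷⋠[] (_ ∷ _ , ())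

  ∷⋠self : ∀ x xs → ¬ (x ∷ xs ≼ xs)
  ∷⋠self x xs (ds , eq) = 1+n≰n (begin
    suc (length xs)        ≤⟨ List.length-++-≤ʳ (x ∷ xs) {ds} ⟩
    length (ds ++ x ∷ xs)  ≡⟨ cong length eq ⟨
    length xs              ∎)
    where open ≤-Reasoning

  ≼-∷⁻ : ∀ {x xs y ys} → x ∷ xs ≼ y ∷ ys → (x ≡ y × xs ≡ ys) ⊎ x ∷ xs ≼ ys
  ≼-∷⁻ ([]     , refl) = inj₁ (refl , refl)
  ≼-∷⁻ (_ ∷ ds , refl) = inj₂ (ds , refl)

  ≼-head-unique : ∀ {x y zs ws} → x ∷ zs ≼ ws → y ∷ zs ≼ ws → x ≡ y
  ≼-head-unique ([]     , refl) ([]     , refl) = refl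
  ≼-head-unique ([]     , refl) (_ ∷ es , eq)   = contradiction (es , List.∷-injectiveʳ eq) (∷⋠self _ _)
  ≼-head-unique (_ ∷ ds , eq)   ([]     , refl) = contradiction (ds , List.∷-injectiveʳ eq) (∷⋠self _ _)
  ≼-head-unique (_ ∷ ds , refl) (_ ∷ es , eq)   = ≼-head-unique (ds , refl) (es , List.∷-injectiveʳ eq)

  reverse-++⇒≼ : ∀ {xs ys} ds → reverse ys ≡ reverse xs ++ ds → xs ≼ ys
  reverse-++⇒≼ {xs} {ys} ds eq = reverse ds , (begin
    ys                                 ≡⟨ List.reverse-involutive ys ⟨
    reverse (reverse ys)               ≡⟨ cong reverse eq ⟩
    reverse (reverse xs ++ ds)         ≡⟨ List.reverse-++ (reverse xs) ds ⟩
    reverse ds ++ reverse (reverse xs) ≡⟨ cong (reverse ds ++_) (List.reverse-involutive xs) ⟩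
    reverse ds ++ xs                   ∎)
    where open ≡-Reasoning

  reverse-∷⇒≼ : ∀ {ys} cs x ds → reverse ys ≡ cs ++ x ∷ ds → x ∷ reverse cs ≼ ys
  reverse-∷⇒≼ {ys} cs x ds eq = reverse-++⇒≼ ds (begin
    reverse ys                      ≡⟨ eq ⟩
    cs ++ x ∷ ds                    ≡⟨ List.∷ʳ-++ cs x ds ⟨
    cs ∷ʳ x ++ ds                   ≡⟨ cong (λ zs → zs ∷ʳ x ++ ds) (List.reverse-involutive cs) ⟨
    reverse (reverse cs) ∷ʳ x ++ ds ≡⟨ cong (_++ ds) (List.unfold-reverse x (reverse cs)) ⟨
    reverse (x ∷ reverse cs) ++ ds  ∎)
    where open ≡-Reasoning

module DecidableSuffix {A : Set} (_≟_ : DecidableEquality A) where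

  infix 4 _≼?_

  _≼?_ : Decidable (_≼_ {A})
  xs ≼? [] with List.≡-dec _≟_ xs []
  ... | yes refl = yes ≼-refl
  ... | no xs≢[] = no λ { ([] , eq) → xs≢[] (sym eq) ; (_ ∷ _ , ()) }
  xs ≼? (y ∷ ys) with List.≡-dec _≟_ xs (y ∷ ys)
  ... | yes refl = yes ≼-refl
  ... | no xs≢ with xs ≼? ys
  ...   | yes xs≼ys = yes (≼-there y xs≼ys)
  ...   | no xs⋠ys  = no λ { ([]     , eq) → xs≢ (sym eq)
                            ; (_ ∷ ds , eq) → xs⋠ys (ds , List.∷-injectiveʳ eq) }

  Diverge : List A → List A → Set
  Diverge xs ys = ∃[ cs ] ∃[ x ] ∃[ y ] (x ≢ y × x ∷ cs ≼ xs × y ∷ cs ≼ ys)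

  private
    prefix-trichotomy : ∀ xs ys → (∃[ ds ] ys ≡ xs ++ ds) ⊎ (∃[ ds ] xs ≡ ys ++ ds)
      ⊎ ∃[ cs ] ∃[ x ] ∃[ y ] ∃[ ds ] ∃[ es ] (x ≢ y × xs ≡ cs ++ x ∷ ds × ys ≡ cs ++ y ∷ es)
    prefix-trichotomy []       ys       = inj₁ (ys , refl)
    prefix-trichotomy (x ∷ xs) []       = inj₂ (inj₁ (x ∷ xs , refl))
    prefix-trichotomy (x ∷ xs) (y ∷ ys) with x ≟ y
    ... | no x≢y  = inj₂ (inj₂ ([] , x , y , xs , ys , x≢y , refl , refl))
    ... | yes refl with prefix-trichotomy xs ys
    ...   | inj₁ (ds , eq)        = inj₁ (ds , cong (x ∷_) eq)
    ...   | inj₂ (inj₁ (ds , eq)) = inj₂ (inj₁ (ds , cong (x ∷_) eq))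
    ...   | inj₂ (inj₂ (cs , x′ , y′ , ds , es , x′≢y′ , eq₁ , eq₂)) =
            inj₂ (inj₂ (x ∷ cs , x′ , y′ , ds , es , x′≢y′ , cong (x ∷_) eq₁ , cong (x ∷_) eq₂))

  ≼-trichotomy : ∀ xs ys → xs ≼ ys ⊎ ys ≼ xs ⊎ Diverge xs ys
  ≼-trichotomy xs ys with prefix-trichotomy (reverse xs) (reverse ys)
  ... | inj₁ (ds , eq)        = inj₁ (reverse-++⇒≼ ds eq)
  ... | inj₂ (inj₁ (ds , eq)) = inj₂ (inj₁ (reverse-++⇒≼ ds eq))
  ... | inj₂ (inj₂ (cs , x , y , ds , es , x≢y , eq₁ , eq₂)) =
        inj₂ (inj₂ (reverse cs , x , y , x≢y , reverse-∷⇒≼ cs x ds eq₁ , reverse-∷⇒≼ cs y es eq₂))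

module _ {A : Set} {R : A → A → Set} where

  AllPairs-∷ʳ⁺ : ∀ {xs x} → AllPairs R xs → All (λ y → R y x) xs → AllPairs R (xs ∷ʳ x)
  AllPairs-∷ʳ⁺ pairs new = AllPairs.++⁺ pairs ([] ∷ []) (All.map (_∷ []) new)

  AllPairs-∷ʳ⁻ : ∀ xs {x} → AllPairs R (xs ∷ʳ x) → AllPairs R xs × All (λ y → R y x) xs
  AllPairs-∷ʳ⁻ []       _                  = [] , []
  AllPairs-∷ʳ⁻ (y ∷ xs) (y-rest ∷ pairs) with AllPairs-∷ʳ⁻ xs pairs | All.∷ʳ⁻ y-rest
  ... | pairs′ , new | y-xs , y-x = y-xs ∷ pairs′ , y-x ∷ new

module MapFacts {n} (M : Map n) where
  open Map M
  open MapNotions M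

  α-injective : Injective _≡_ _≡_ αf
  α-injective {a} {b} eq = begin
    a           ≡⟨ α-invol a ⟨
    αf (αf a)   ≡⟨ cong αf eq ⟩
    αf (αf b)   ≡⟨ α-invol b ⟩
    b           ∎
    where open ≡-Reasoning

  α-flip : ∀ {x y} → x ≡ αf y → αf x ≡ y
  α-flip {y = y} eq = trans (cong αf eq) (α-invol y)

  σ-injective : Injective _≡_ _≡_ σf
  σ-injective {a} {b} eq = begin
    a                  ≡⟨ inverseˡ σ ⟨
    σ ⟨$⟩ˡ σf a        ≡⟨ cong (σ ⟨$⟩ˡ_) eq ⟩
    σ ⟨$⟩ˡ σf b        ≡⟨ inverseˡ σ ⟩
    b                  ∎
    where open ≡-Reasoning

  infix 4 _∼_

  _∼_ : Fin n → Fin n → Set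
  _∼_ = SameVertex

  ≡⇒∼ : ∀ {a b} → a ≡ b → a ∼ b
  ≡⇒∼ eq = 0 , eq

  ∼-refl : ∀ {a} → a ∼ a
  ∼-refl = ≡⇒∼ refl

  ∼-trans : ∀ {a b c} → a ∼ b → b ∼ c → a ∼ c
  ∼-trans {a} (k , refl) (j , refl) = j + k , iter-+ j k a

  ∼-sym : ∀ {a b} → a ∼ b → b ∼ a
  ∼-sym (k , eq) = iter-reverse σ-injective {k} eq

  ∼-σ : ∀ {a b} → a ∼ b → a ∼ σf b
  ∼-σ (k , eq) = suc k , cong σf eq

  SameEdge-α : ∀ {g x} → SameEdge g x → SameEdge g (αf x)
  SameEdge-α     (inj₁ refl) = inj₂ refl
  SameEdge-α {g} (inj₂ refl) = inj₁ (α-invol g)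

  SameEdge-cases : ∀ {g x y} → SameEdge g x → SameEdge g y → x ≡ y ⊎ y ≡ αf x
  SameEdge-cases     (inj₁ refl) (inj₁ refl) = inj₁ refl
  SameEdge-cases     (inj₁ refl) (inj₂ refl) = inj₂ refl
  SameEdge-cases {g} (inj₂ refl) (inj₁ refl) = inj₂ (sym (α-invol g))
  SameEdge-cases     (inj₂ refl) (inj₂ refl) = inj₁ refl

module TourStack {n} (M : Map n) (S : Fin n → Bool)
                 (tree : MapNotions.InSubgraph.IsSpanningTree M S) (r : Fin n) where
  open Map M
  open MapNotions M
  open InSubgraph S
  open MapFacts M
  open DecidableSuffix (Fin._≟_ {n})

  S-α : ∀ b → S (αf b) ≡ S b
  S-α = proj₁ tree

  connected : ∀ x y → ∃[ bs ] Walk x y bs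
  connected = proj₁ (proj₂ tree)

  acyclic : ∀ bs → ¬ Cycle bs
  acyclic = proj₂ (proj₂ tree)

  InS-α : ∀ {b} → InS b → InS (αf b)
  InS-α {b} b∈S = trans (S-α b) b∈S

  tour-∈S : ∀ {b} → InS b → tour b ≡ σf (αf b)
  tour-∈S b∈S rewrite b∈S = refl

  tour-∉S : ∀ {b} → S b ≡ false → tour b ≡ σf b
  tour-∉S b∉S rewrite b∉S = refl

  tour-injective : Injective _≡_ _≡_ tour
  tour-injective {a} {b} eq with S a in Sa | S b in Sb
  ... | true  | true  = α-injective (σ-injective eq)
  ... | false | false = σ-injective eq
  ... | true  | false = contradiction (trans (sym Sb) (trans (cong S (sym (σ-injective eq))) (trans (S-α a) Sa)))
                                      λ ()
  ... | false | true  = contradiction (trans (sym Sa) (trans (cong S (σ-injective eq)) (trans (S-α b) Sb)))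
                                      λ ()

  w : ℕ → Fin n
  w = letter r

  pushOrPop : List (Fin n) → Fin n → List (Fin n)
  pushOrPop []      x = x ∷ []
  pushOrPop (y ∷ R) x with x Fin.≟ αf y
  ... | yes _ = R
  ... | no  _ = x ∷ y ∷ R

  step : List (Fin n) → Fin n → List (Fin n)
  step R x = if S x then pushOrPop R x else R

  stack : ℕ → List (Fin n)
  stack zero    = []
  stack (suc m) = step (stack m) (w m)

  DoesNotPop : List (Fin n) → Fin n → Set
  DoesNotPop R x = ∀ {y R′} → R ≡ y ∷ R′ → x ≢ αf y

  data StepView (R : List (Fin n)) (x : Fin n) : Set where
    skip : S x ≡ false → step R x ≡ R → StepView R x
    pop  : ∀ {y} → InS x → R ≡ y ∷ step R x → x ≡ αf y → StepView R x
    push : InS x → DoesNotPop R x → step R x ≡ x ∷ R → StepView R x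

  pushOrPop-view : ∀ R x → (∃[ y ] (R ≡ y ∷ pushOrPop R x × x ≡ αf y))
                           ⊎ (DoesNotPop R x × pushOrPop R x ≡ x ∷ R)
  pushOrPop-view []      x = inj₂ ((λ ()) , refl)
  pushOrPop-view (y ∷ R) x with x Fin.≟ αf y
  ... | yes x≡αy = inj₁ (y , refl , x≡αy)
  ... | no  x≢αy = inj₂ ((λ { refl → x≢αy }) , refl)

  step-∈S : ∀ {R x} → InS x → step R x ≡ pushOrPop R x
  step-∈S x∈S rewrite x∈S = refl

  step-∉S : ∀ {R x} → S x ≡ false → step R x ≡ R
  step-∉S x∉S rewrite x∉S = refl

  stepView : ∀ R x → StepView R x
  stepView R x with S x in Sx | pushOrPop-view R x
  ... | false | _                        = skip Sx (step-∉S Sx)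
  ... | true  | inj₁ (y , R≡y∷ , x≡αy) = pop Sx (trans R≡y∷ (cong (y ∷_) (sym (step-∈S Sx)))) x≡αy
  ... | true  | inj₂ (np , pushes)     = push Sx np (trans (step-∈S Sx) pushes)

  stepAt : ∀ m → StepView (stack m) (w m)
  stepAt m = stepView (stack m) (w m)

  endpoint : List (Fin n) → Fin n
  endpoint []      = r
  endpoint (y ∷ _) = αf y

  vertices : List (Fin n) → List (Fin n)
  vertices R = r ∷ map αf R

  -- Stacks are stored top first: y ∷ R is the root path R followed by the edge of y,
  -- traversed from the vertex of y to that of αf y.
  IsRootPath : List (Fin n) → Set
  IsRootPath []      = ⊤
  IsRootPath (y ∷ R) = IsRootPath R × endpoint R ∼ y × InS y × ¬ Any (_∼ αf y) (vertices R)

  RootPathTo : List (Fin n) → Fin n → Set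
  RootPathTo R x = IsRootPath R × endpoint R ∼ x

  vertices-there : ∀ {P : Fin n → Set} y R → Any P (vertices R) → Any P (vertices (y ∷ R))
  vertices-there y R (here p)  = here p
  vertices-there y R (there p) = there (there p)

  ++-vertices : ∀ {P : Fin n → Set} ds R → P (endpoint R) → Any P (vertices (ds ++ R))
  ++-vertices []       []      p = here p
  ++-vertices []       (y ∷ R) p = there (here p)
  ++-vertices (y ∷ ds) R       p = vertices-there y (ds ++ R) (++-vertices ds R p)

  vertices-≼ : ∀ {P : Fin n → Set} R → Any P (vertices R) → ∃[ R′ ] (R′ ≼ R × P (endpoint R′))
  vertices-≼ []      (here p)          = [] , ≼-refl , p
  vertices-≼ (y ∷ R) (here p)          = [] , (y ∷ R , sym (List.++-identityʳ (y ∷ R))) , p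
  vertices-≼ (y ∷ R) (there (here p))  = y ∷ R , ≼-refl , p
  vertices-≼ (y ∷ R) (there (there p)) with vertices-≼ R (there p)
  ... | R′ , R′≼R , p′ = R′ , ≼-there y R′≼R , p′

  ¬Any-vertices⇒All : ∀ {Q : Fin n → Set} R → ¬ Any Q (vertices R) → All (λ y → ¬ Q (αf y)) R
  ¬Any-vertices⇒All R ¬visited = All.map⁻ (All.tail (All.¬Any⇒All¬ (vertices R) ¬visited))

  IsRootPath-≼ : ∀ {R′ R} → R′ ≼ R → IsRootPath R → IsRootPath R′
  IsRootPath-≼ ([]     , refl) rp = rp
  IsRootPath-≼ (_ ∷ ds , refl) rp = IsRootPath-≼ (ds , refl) (proj₁ rp)

  sources-visited : ∀ R → IsRootPath R → All (λ y → Any (_∼ y) (vertices R)) R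
  sources-visited []      _               = []
  sources-visited (y ∷ R) (rp , e∼y , _) =
    ++-vertices (y ∷ []) R e∼y ∷ All.map (vertices-there y R) (sources-visited R rp)

  Trail : Fin n → List (Fin n) → Set
  Trail x []       = ⊤
  Trail x (b ∷ bs) = x ∼ b × InS b × Trail (αf b) bs

  chain⇒trail : ∀ {x} b bs → x ∼ b → All InS (b ∷ bs) → Chain (b ∷ bs) → Trail x (b ∷ bs)
  chain⇒trail b []       x∼b (b∈S ∷ [])  _            = x∼b , b∈S , tt
  chain⇒trail b (c ∷ cs) x∼b (b∈S ∷ ins) (αb∼c , ch) = x∼b , b∈S , chain⇒trail c cs αb∼c ins ch

  trail⇒chain : ∀ {x} b bs → Trail x (b ∷ bs) → x ∼ b × All InS (b ∷ bs) × Chain (b ∷ bs)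
  trail⇒chain b []       (x∼b , b∈S , _)     = x∼b , b∈S ∷ [] , tt
  trail⇒chain b (c ∷ cs) (x∼b , b∈S , trail) with trail⇒chain c cs trail
  ... | αb∼c , ins , ch = x∼b , b∈S ∷ ins , αb∼c , ch

  walk⇒trail : ∀ {x y} bs → Walk x y bs → Trail x bs × lastEnd x bs ∼ y
  walk⇒trail []       x∼y                  = tt , x∼y
  walk⇒trail (b ∷ bs) (x∼b , ins , ch , end) = chain⇒trail b bs x∼b ins ch , end

  trail⇒walk : ∀ {x y} bs → Trail x bs → lastEnd x bs ∼ y → Walk x y bs
  trail⇒walk []       _     end = end
  trail⇒walk (b ∷ bs) trail end with trail⇒chain b bs trail
  ... | x∼b , ins , ch = x∼b , ins , ch , end

  retrace : ∀ ds {R} x → IsRootPath (ds ++ R) → x ∼ endpoint (ds ++ R)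
          → Trail x (map αf ds) × lastEnd x (map αf ds) ∼ endpoint R
  retrace []       x _                    x∼e  = tt , x∼e
  retrace (y ∷ ds) {R} x (rp , e∼y , y∈S , _) x∼αy
    with retrace ds (αf (αf y)) rp (subst (_∼ endpoint (ds ++ R)) (sym (α-invol y)) (∼-sym e∼y))
  ... | trail , end = (x∼αy , InS-α y∈S , trail) , end

  segment-avoids-base : ∀ ds {R} → IsRootPath (ds ++ R) → All (λ v → ¬ endpoint R ∼ v) (map αf ds)
  segment-avoids-base []       _                   = []
  segment-avoids-base (y ∷ ds) {R} (rp , _ , _ , fresh) =
    (λ e∼αy → fresh (++-vertices ds R e∼αy)) ∷ segment-avoids-base ds rp

  segment-vertices-distinct : ∀ ds {R} → IsRootPath (ds ++ R) → AllPairs (λ u v → ¬ u ∼ v) (map αf ds)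
  segment-vertices-distinct []       _                   = []
  segment-vertices-distinct (y ∷ ds) {R} (rp , _ , _ , fresh) =
    All.map⁺ (All.map (λ ¬αz∼αy αy∼αz → ¬αz∼αy (∼-sym αy∼αz))
                      (All.++⁻ˡ ds (¬Any-vertices⇒All (ds ++ R) fresh)))
    ∷ segment-vertices-distinct ds rp

  segment-edges-distinct : ∀ ds {R} → IsRootPath (ds ++ R) → AllPairs (λ u v → ¬ SameEdge u v) (map αf ds)
  segment-edges-distinct []       _                   = []
  segment-edges-distinct (y ∷ ds) {R} (rp , _ , _ , fresh) =
    All.map⁺ (All.zipWith distinct ( All.++⁻ˡ ds (¬Any-vertices⇒All (ds ++ R) fresh)
                                   , All.++⁻ˡ ds (sources-visited (ds ++ R) rp)))
    ∷ segment-edges-distinct ds rp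
    where
    distinct : ∀ {z} → ¬ αf z ∼ αf y × Any (_∼ z) (vertices (ds ++ R)) → ¬ SameEdge (αf y) (αf z)
    distinct (¬αz∼αy , _)        (inj₁ αz≡αy)  = ¬αz∼αy (≡⇒∼ αz≡αy)
    distinct (_      , z-visited) (inj₂ αz≡ααy) =
      fresh (subst (λ v → Any (_∼ v) _) (α-injective αz≡ααy) z-visited)

  not-popping-avoids : ∀ {R x} → RootPathTo R x → DoesNotPop R x → All (_≢ αf x) R
  not-popping-avoids {[]}    _                             _  = []
  not-popping-avoids {a ∷ R} {x} ((_ , _ , _ , fresh) , αa∼x) np =
    (λ a≡αx → np refl (sym (α-flip a≡αx)))
    ∷ All.map (λ ¬αy∼αa y≡αx → ¬αy∼αa (∼-sym (subst (αf a ∼_) (sym (α-flip y≡αx)) αa∼x)))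
              (¬Any-vertices⇒All R fresh)

  push-fresh : ∀ {R x} → RootPathTo R x → InS x → DoesNotPop R x → ¬ Any (_∼ αf x) (vertices R)
  push-fresh {R} {x} (rp , e∼x) x∈S np visited with vertices-≼ R visited
  ... | R′ , (ds , refl) , e′∼αx = acyclic (αf x ∷ map αf ds) (walk , distinct-vertices , distinct-edges)
    where
    retraced : Trail (αf (αf x)) (map αf ds) × lastEnd (αf (αf x)) (map αf ds) ∼ endpoint R′
    retraced = retrace ds (αf (αf x)) rp (subst (_∼ endpoint R) (sym (α-invol x)) (∼-sym e∼x))

    walk : Walk (αf x) (αf x) (αf x ∷ map αf ds)
    walk = trail⇒walk (αf x ∷ map αf ds) (∼-refl , InS-α x∈S , proj₁ retraced)
                                         (∼-trans (proj₂ retraced) e′∼αx)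

    head-vertex : All (λ v → ¬ αf x ∼ v) (map αf ds)
    head-vertex = All.map (λ ¬e′∼v αx∼v → ¬e′∼v (∼-trans e′∼αx αx∼v)) (segment-avoids-base ds rp)

    head-edge : ∀ {y} → ¬ αf x ∼ αf y × y ≢ αf x → ¬ SameEdge (αf x) (αf y)
    head-edge (¬αx∼αy , _)    (inj₁ αy≡αx)  = ¬αx∼αy (≡⇒∼ (sym αy≡αx))
    head-edge (_      , y≢αx) (inj₂ αy≡ααx) = y≢αx (α-injective αy≡ααx)

    distinct-vertices : AllPairs (λ u v → ¬ u ∼ v) (αf x ∷ map αf ds)
    distinct-vertices = head-vertex ∷ segment-vertices-distinct ds rp

    distinct-edges : AllPairs (λ u v → ¬ SameEdge u v) (αf x ∷ map αf ds)
    distinct-edges =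
      All.map⁺ (All.zipWith head-edge (All.map⁻ head-vertex , All.++⁻ˡ ds (not-popping-avoids (rp , e∼x) np)))
      ∷ segment-edges-distinct ds rp

  stack-rooted : ∀ m → RootPathTo (stack m) (w m)
  stack-rooted zero = tt , ∼-refl
  stack-rooted (suc m) with stack-rooted m | stepAt m
  ... | rp , e∼x | skip x∉S same =
    subst (λ L → RootPathTo L (w (suc m))) (sym same)
          (rp , subst (endpoint (stack m) ∼_) (sym (tour-∉S x∉S)) (∼-σ e∼x))
  ... | rp , e∼x | push x∈S np pushes =
    subst (λ L → RootPathTo L (w (suc m))) (sym pushes)
          ( (rp , e∼x , x∈S , push-fresh (rp , e∼x) x∈S np)
          , subst (αf (w m) ∼_) (sym (tour-∈S x∈S)) (∼-σ ∼-refl))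
  ... | rp , e∼x | pop {y} x∈S pops x≡αy with subst IsRootPath pops rp
  ...   | rp′ , e′∼y , _ = rp′ , subst (endpoint (stack (suc m)) ∼_) (sym tour≡σy) (∼-σ e′∼y)
    where
    tour≡σy : tour (w m) ≡ σf y
    tour≡σy = trans (tour-∈S x∈S) (cong σf (α-flip x≡αy))

  suffix-lost : ∀ {k e c} → e ∷ c ≼ stack k → ¬ (e ∷ c ≼ stack (suc k))
              → w k ≡ αf e × stack k ≡ e ∷ c × stack (suc k) ≡ c
  suffix-lost {k} {e} {c} s ¬s with stepAt k
  ... | skip _ same      = contradiction (subst (e ∷ c ≼_) (sym same) s) ¬s
  ... | push _ _ pushes  = contradiction (subst (e ∷ c ≼_) (sym pushes) (≼-there (w k) s)) ¬s
  ... | pop _ pops x≡αy with ≼-∷⁻ (subst (e ∷ c ≼_) pops s)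
  ...   | inj₁ (refl , c≡) = x≡αy , trans pops (cong (e ∷_) (sym c≡)) , sym c≡
  ...   | inj₂ s′          = contradiction s′ ¬s

  suffix-gained : ∀ {k e c} → ¬ (e ∷ c ≼ stack k) → e ∷ c ≼ stack (suc k)
                → w k ≡ e × stack k ≡ c × stack (suc k) ≡ e ∷ c × InS e
  suffix-gained {k} {e} {c} ¬s s with stepAt k
  ... | skip _ same     = contradiction (subst (e ∷ c ≼_) same s) ¬s
  ... | pop {y} _ pops _ = contradiction (subst (e ∷ c ≼_) (sym pops) (≼-there y s)) ¬s
  ... | push x∈S _ pushes with ≼-∷⁻ (subst (e ∷ c ≼_) pushes s)
  ...   | inj₁ (refl , c≡) = refl , sym c≡ , trans pushes (cong (e ∷_) (sym c≡)) , x∈S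
  ...   | inj₂ s′          = contradiction s′ ¬s

  popped-between : ∀ {m m′ e c} → m ≤ m′ → e ∷ c ≼ stack m → ¬ (e ∷ c ≼ stack m′)
    → ∃[ k ] (m ≤ k × k < m′ × w k ≡ αf e × stack k ≡ e ∷ c × stack (suc k) ≡ c)
  popped-between {e = e} {c} m≤m′ s ¬s
    with first-change (λ k → e ∷ c ≼ stack k) (λ k → e ∷ c ≼? stack k) m≤m′ s ¬s
  ... | k , m≤k , k<m′ , sk , ¬s1+k = k , m≤k , k<m′ , suffix-lost {k} sk ¬s1+k

  pushed-between : ∀ {m m′ e c} → m ≤ m′ → ¬ (e ∷ c ≼ stack m) → e ∷ c ≼ stack m′
    → ∃[ k ] (m ≤ k × k < m′ × w k ≡ e × stack k ≡ c × stack (suc k) ≡ e ∷ c × InS e)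
  pushed-between {e = e} {c} m≤m′ ¬s s
    with first-change (λ k → ¬ (e ∷ c ≼ stack k)) (λ k → ¬? (e ∷ c ≼? stack k)) m≤m′ ¬s (λ ¬s′ → ¬s′ s)
  ... | k , m≤k , k<m′ , ¬sk , ¬¬s1+k =
        k , m≤k , k<m′ , suffix-gained {k} ¬sk (decidable-stable (e ∷ c ≼? stack (suc k)) ¬¬s1+k)

  pushed-earlier : ∀ m {y R} → stack m ≡ y ∷ R
    → ∃[ k ] (k < m × w k ≡ y × stack k ≡ R × stack (suc k) ≡ y ∷ R × InS y)
  pushed-earlier m {y} {R} eq with pushed-between z≤n ∷⋠[] (subst (y ∷ R ≼_) (sym eq) ≼-refl)
  ... | k , _ , k<m , pushed = k , k<m , pushed

  module _ {d} (w-d : w d ≡ r) where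

    stack-returns : stack d ≡ []
    stack-returns with stack d | stack-rooted d
    ... | []    | _                                 = refl
    ... | y ∷ R | (_ , _ , _ , fresh) , αy∼wd = contradiction (here (∼-sym (subst (αf y ∼_) w-d αy∼wd))) fresh

    w-periodic : ∀ j → w (j + d) ≡ w j
    w-periodic j = trans (iter-+ j d r) (cong (iter tour j) w-d)

    stack-periodic : ∀ j → stack (j + d) ≡ stack j
    stack-periodic zero    = stack-returns
    stack-periodic (suc j) = cong₂ step (stack-periodic j) (w-periodic j)

  eventually-empty : ∀ m → ∃[ N ] (m ≤ N × stack N ≡ [])
  eventually-empty m with iter-returns tour-injective r
  ... | d , 0<d , _ , w-d = m * d , m≤m*n m d , periodic-+* (stack-periodic w-d) 0 m
    where instance _ = >-nonZero 0<d

  popped-later : ∀ m → stack (suc m) ≡ w m ∷ stack m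
    → ∃[ k ] (m < k × w k ≡ αf (w m) × stack k ≡ w m ∷ stack m × stack (suc k) ≡ stack m)
  popped-later m pushes with eventually-empty (suc m)
  ... | N , m<N , empty with popped-between m<N (subst (w m ∷ stack m ≼_) (sym pushes) ≼-refl)
                                               (λ s → ∷⋠[] (subst (w m ∷ stack m ≼_) empty s))
  ...   | k , m<k , _ , popped = k , m<k , popped

  -- The tour visits each flag once in n steps

  σ-step : ∀ m → ∃[ m′ ] (w m′ ≡ σf (w m) × stack m′ ≡ stack m)
  σ-step m with stepAt m
  ... | skip x∉S same = suc m , tour-∉S x∉S , same
  ... | pop {y} _ pops x≡αy with pushed-earlier m pops
  ...   | k , _ , wk≡y , _ , pushed , y∈S =
          suc k , trans (cong tour wk≡y) (trans (tour-∈S y∈S) (cong σf (sym x≡αy))) , trans pushed (sym pops)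
  σ-step m | push x∈S _ pushes with popped-later m pushes
  ...   | k , _ , wk≡αx , _ , popped =
          suc k , trans (cong tour wk≡αx) (trans (tour-∈S (InS-α x∈S)) (cong σf (α-invol (w m)))) , popped

  vertex-visited : ∀ m {y} → w m ∼ y → ∃[ m′ ] (w m′ ≡ y × stack m′ ≡ stack m)
  vertex-visited m (zero  , refl) = m , refl , refl
  vertex-visited m (suc k , refl) with vertex-visited m (k , refl)
  ... | m₁ , eq₁ , same₁ with σ-step m₁
  ...   | m₂ , eq₂ , same₂ = m₂ , trans eq₂ (cong σf eq₁) , trans same₂ same₁

  α-visited : ∀ m → InS (w m) → ∃[ m′ ] w m′ ≡ αf (w m)
  α-visited m x∈S with stepAt m
  ... | skip x∉S _ = contradiction (trans (sym x∈S) x∉S) λ ()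
  ... | pop {y} _ pops x≡αy with pushed-earlier m pops
  ...   | k , _ , wk≡y , _ = k , trans wk≡y (sym (α-flip x≡αy))
  α-visited m x∈S | push _ _ pushes with popped-later m pushes
  ...   | k , _ , wk≡αx , _ = k , wk≡αx

  trail-visited : ∀ bs {x} → ∃[ m ] w m ≡ x → Trail x bs → ∃[ m ] w m ≡ lastEnd x bs
  trail-visited []       visited       _                   = visited
  trail-visited (b ∷ bs) (m , refl) (x∼b , b∈S , trail) with vertex-visited m x∼b
  ... | m₁ , wm₁≡b , _ with α-visited m₁ (subst InS (sym wm₁≡b) b∈S)
  ...   | m₂ , wm₂≡αwm₁ = trail-visited bs (m₂ , trans wm₂≡αwm₁ (cong αf wm₁≡b)) trail

  every-flag-visited : ∀ z → ∃[ m ] w m ≡ z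
  every-flag-visited z with connected r z
  ... | bs , walk with walk⇒trail bs walk
  ...   | trail , end∼z with trail-visited bs (0 , refl) trail
  ...     | m , wm≡end with vertex-visited m (subst (_∼ z) (sym wm≡end) end∼z)
  ...       | m′ , wm′≡z , _ = m′ , wm′≡z

  visited-before-return : ∀ {d} → 0 < d → w d ≡ r → ∀ z → ∃[ m ] (m < d × w m ≡ z)
  visited-before-return {d} 0<d w-d z with every-flag-visited z
  ... | m , refl = m % d , m%n<n m d , sym (periodic-% (w-periodic w-d) m)
    where instance _ = >-nonZero 0<d

  n≤return-time : ∀ {d} → 0 < d → w d ≡ r → n ≤ d
  n≤return-time {d} 0<d w-d = Fin.injective⇒≤ index-injective
    where
    visit : ∀ z → ∃[ m ] (m < d × w m ≡ z)
    visit = visited-before-return 0<d w-d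

    index : Fin n → Fin d
    index z = fromℕ< (proj₁ (proj₂ (visit z)))

    index-injective : Injective _≡_ _≡_ index
    index-injective {z₁} {z₂} eq = begin
      z₁                   ≡⟨ proj₂ (proj₂ (visit z₁)) ⟨
      w (proj₁ (visit z₁)) ≡⟨ cong w (Fin.fromℕ<-injective _ _ (proj₁ (proj₂ (visit z₁)))
                                                                (proj₁ (proj₂ (visit z₂))) eq) ⟩
      w (proj₁ (visit z₂)) ≡⟨ proj₂ (proj₂ (visit z₂)) ⟩
      z₂                   ∎
      where open ≡-Reasoning

  w-n : w n ≡ r
  w-n with iter-returns tour-injective r
  ... | d , 0<d , d≤n , w-d = subst (λ k → w k ≡ r) (≤-antisym d≤n (n≤return-time 0<d w-d)) w-d

  stack-n : stack n ≡ []
  stack-n = stack-returns {n} w-n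

  no-repeat-before-n : ∀ {i j} → i < j → j < n → w i ≢ w j
  no-repeat-before-n {i} {j} i<j j<n eq = <⇒≱ j<n (begin
    n     ≤⟨ n≤return-time (m<n⇒0<n∸m i<j) (iter-∸ tour-injective r (<⇒≤ i<j) eq) ⟩
    j ∸ i ≤⟨ m∸n≤m j i ⟩
    j     ∎)
    where open ≤-Reasoning

  w-injective : ∀ {i j} → i < n → j < n → w i ≡ w j → i ≡ j
  w-injective {i} {j} i<n j<n eq with <-cmp i j
  ... | tri< i<j _ _ = contradiction eq (no-repeat-before-n i<j j<n)
  ... | tri≈ _ i≡j _ = i≡j
  ... | tri> _ _ j<i = contradiction (sym eq) (no-repeat-before-n j<i i<n)

  instance
    n-nonZero : NonZero n
    n-nonZero = >-nonZero (≤-<-trans z≤n (Fin.toℕ<n r))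

  position : ∀ z → ∃[ m ] (m < n × w m ≡ z)
  position = visited-before-return (>-nonZero⁻¹ n) w-n

  w-determines-stack : ∀ a b → w a ≡ w b → stack a ≡ stack b
  w-determines-stack a b eq = begin
    stack a       ≡⟨ periodic-% (stack-periodic w-n) a ⟩
    stack (a % n) ≡⟨ cong stack (w-injective (m%n<n a n) (m%n<n b n) w-mod≡) ⟩
    stack (b % n) ≡⟨ periodic-% (stack-periodic w-n) b ⟨
    stack b       ∎
    where
    open ≡-Reasoning
    w-mod≡ : w (a % n) ≡ w (b % n)
    w-mod≡ = trans (sym (periodic-% (w-periodic w-n) a)) (trans eq (periodic-% (w-periodic w-n) b))

  -- Ancestry is the suffix order of stacks

  rootPath-occurs : ∀ R → IsRootPath R → ∃[ m ] stack m ≡ R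
  rootPath-occurs []      _                       = 0 , refl
  rootPath-occurs (y ∷ R) (rp , e∼y , y∈S , fresh) with rootPath-occurs R rp
  ... | m , refl with vertex-visited m (∼-trans (∼-sym (proj₂ (stack-rooted m))) e∼y)
  ...   | m′ , refl , same with stepAt m′
  ...     | skip y∉S _      = contradiction (trans (sym y∈S) y∉S) λ ()
  ...     | push _ _ pushes = suc m′ , trans pushes (cong (w m′ ∷_) same)
  ...     | pop {z} _ pops y≡αz = contradiction αy-visited fresh
    where
    e′∼αy : endpoint (stack (suc m′)) ∼ αf (w m′)
    e′∼αy = subst (endpoint (stack (suc m′)) ∼_) (sym (α-flip y≡αz))
                  (proj₁ (proj₂ (subst IsRootPath pops (proj₁ (stack-rooted m′)))))

    αy-visited : Any (_∼ αf (w m′)) (vertices (stack m))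
    αy-visited = subst (λ L → Any (_∼ αf (w m′)) (vertices L)) (trans (sym pops) same)
                       (++-vertices (z ∷ []) (stack (suc m′)) e′∼αy)

  stack-determined : ∀ a {R} → RootPathTo R (w a) → stack a ≡ R
  stack-determined a {R} (rp , e∼wa) with rootPath-occurs R rp
  ... | m , refl with vertex-visited m (∼-trans (∼-sym (proj₂ (stack-rooted m))) e∼wa)
  ...   | m′ , wm′≡wa , same = trans (w-determines-stack a m′ (sym wm′≡wa)) same

  DistinctVisits : List (Fin n) → Set
  DistinctVisits bs = AllPairs (λ u v → ¬ u ∼ v) (visited r bs)

  Trail-∷ʳ⁺ : ∀ x bs {b} → Trail x bs → lastEnd x bs ∼ b → InS b → Trail x (bs ∷ʳ b)
  Trail-∷ʳ⁺ x []       _                   end∼b b∈S = end∼b , b∈S , tt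
  Trail-∷ʳ⁺ x (c ∷ bs) (x∼c , c∈S , trail) end∼b b∈S = x∼c , c∈S , Trail-∷ʳ⁺ (αf c) bs trail end∼b b∈S

  Trail-∷ʳ⁻ : ∀ x bs {b} → Trail x (bs ∷ʳ b) → Trail x bs × lastEnd x bs ∼ b × InS b
  Trail-∷ʳ⁻ x []       (x∼b , b∈S , _)     = tt , x∼b , b∈S
  Trail-∷ʳ⁻ x (c ∷ bs) (x∼c , c∈S , trail) with Trail-∷ʳ⁻ (αf c) bs trail
  ... | trail′ , end∼b , b∈S = (x∼c , c∈S , trail′) , end∼b , b∈S

  lastEnd-∷ʳ : ∀ x bs b → lastEnd x (bs ∷ʳ b) ≡ αf b
  lastEnd-∷ʳ x []       b = refl
  lastEnd-∷ʳ x (c ∷ bs) b = lastEnd-∷ʳ (αf c) bs b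

  lastEnd-reverse : ∀ R → lastEnd r (reverse R) ≡ endpoint R
  lastEnd-reverse []      = refl
  lastEnd-reverse (y ∷ R) = trans (cong (lastEnd r) (List.unfold-reverse y R)) (lastEnd-∷ʳ r (reverse R) y)

  visited-∷ʳ : ∀ x bs b → visited x (bs ∷ʳ b) ≡ visited x bs ∷ʳ αf b
  visited-∷ʳ x bs b = cong (x ∷_) (List.map-++ αf bs (b ∷ []))

  visited-reverse⁺ : ∀ {P : Fin n → Set} R → Any P (vertices R) → Any P (visited r (reverse R))
  visited-reverse⁺ R (here p)  = here p
  visited-reverse⁺ R (there p) = there (Any.map⁺ (Any.reverse⁺ (Any.map⁻ p)))

  visited-reverse⁻ : ∀ {P : Fin n → Set} R → Any P (visited r (reverse R)) → Any P (vertices R)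
  visited-reverse⁻ R (here p)  = here p
  visited-reverse⁻ R (there p) = there (Any.map⁺ (Any.reverse⁻ (Any.map⁻ p)))

  rootPath⇒trail : ∀ R → IsRootPath R → Trail r (reverse R) × DistinctVisits (reverse R)
  rootPath⇒trail []      _                       = tt , [] ∷ []
  rootPath⇒trail (y ∷ R) (rp , e∼y , y∈S , fresh) with rootPath⇒trail R rp
  ... | trail , distinct =
    subst (λ bs → Trail r bs × DistinctVisits bs) (sym (List.unfold-reverse y R))
      ( Trail-∷ʳ⁺ r (reverse R) trail (subst (_∼ y) (sym (lastEnd-reverse R)) e∼y) y∈S
      , subst (AllPairs _) (sym (visited-∷ʳ r (reverse R) y))
              (AllPairs-∷ʳ⁺ distinct (All.¬Any⇒All¬ _ (λ v → fresh (visited-reverse⁻ R v)))))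

  trail⇒rootPath : ∀ R → Trail r (reverse R) → DistinctVisits (reverse R) → IsRootPath R
  trail⇒rootPath []      _     _        = tt
  trail⇒rootPath (y ∷ R) trail distinct
    with Trail-∷ʳ⁻ r (reverse R) (subst (Trail r) (List.unfold-reverse y R) trail)
       | AllPairs-∷ʳ⁻ (visited r (reverse R))
           (subst (AllPairs _) (visited-∷ʳ r (reverse R) y)
                  (subst DistinctVisits (List.unfold-reverse y R) distinct))
  ... | trail′ , end∼y , y∈S | distinct′ , new =
    trail⇒rootPath R trail′ distinct′ , subst (_∼ y) (lastEnd-reverse R) end∼y , y∈S
    , λ v → All.All¬⇒¬Any new (visited-reverse⁺ R v)

  rootPath⇒path : ∀ {R y} → RootPathTo R y → Path r y (reverse R)
  rootPath⇒path {R} {y} (rp , e∼y) with rootPath⇒trail R rp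
  ... | trail , distinct =
    trail⇒walk (reverse R) trail (subst (_∼ y) (sym (lastEnd-reverse R)) e∼y) , distinct

  path⇒rootPath : ∀ {bs y} → Path r y bs → RootPathTo (reverse bs) y
  path⇒rootPath {bs} {y} (walk , distinct) with walk⇒trail bs walk
  ... | trail , end∼y =
    trail⇒rootPath (reverse bs) (subst (Trail r) (sym involutive) trail)
                                (subst DistinctVisits (sym involutive) distinct)
    , subst (_∼ y) (trans (cong (lastEnd r) (sym involutive)) (lastEnd-reverse (reverse bs))) end∼y
    where
    involutive : reverse (reverse bs) ≡ bs
    involutive = List.reverse-involutive bs

  ancestor⇒≼ : ∀ a b → Ancestor r (w a) (w b) → stack a ≼ stack b
  ancestor⇒≼ a b (bs , path , on-path)
    with vertices-≼ (reverse bs) (visited-reverse⁻ (reverse bs)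
           (subst (λ L → Any (w a ∼_) (visited r L)) (sym (List.reverse-involutive bs)) on-path))
  ... | R′ , R′≼bs , wa∼e′ =
    subst₂ _≼_ (sym (stack-determined a (IsRootPath-≼ R′≼bs (proj₁ rooted) , ∼-sym wa∼e′)))
               (sym (stack-determined b rooted)) R′≼bs
    where
    rooted : RootPathTo (reverse bs) (w b)
    rooted = path⇒rootPath path

  ≼⇒ancestor : ∀ a b → stack a ≼ stack b → Ancestor r (w a) (w b)
  ≼⇒ancestor a b (ds , eq) = reverse (stack b) , rootPath⇒path (stack-rooted b)
    , visited-reverse⁺ (stack b) (subst (λ L → Any (w a ∼_) (vertices L)) (sym eq)
                                        (++-vertices ds (stack a) (∼-sym (proj₂ (stack-rooted a)))))

  InS-SameEdge : ∀ {g x} → InS g → SameEdge g x → InS x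
  InS-SameEdge g∈S (inj₁ refl) = g∈S
  InS-SameEdge g∈S (inj₂ refl) = InS-α g∈S

  second-occurrence : ∀ {g a b} → a < b → b < n → At r a g → At r b g → w b ≡ αf (w a)
  second-occurrence a<b b<n Aa Ab with SameEdge-cases Aa Ab
  ... | inj₁ wa≡wb  = contradiction (w-injective (<-trans a<b b<n) b<n wa≡wb) (<⇒≢ a<b)
  ... | inj₂ wb≡αwa = wb≡αwa

  occurrences : ∀ {g a b c} → a < b → b < n → c < n → At r a g → At r b g → At r c g → c ≡ a ⊎ c ≡ b
  occurrences a<b b<n c<n Aa Ab Ac with SameEdge-cases Aa Ac
  ... | inj₁ wa≡wc  = inj₁ (w-injective c<n (<-trans a<b b<n) (sym wa≡wc))
  ... | inj₂ wc≡αwa = inj₂ (w-injective c<n b<n (trans wc≡αwa (sym (second-occurrence a<b b<n Aa Ab))))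

  At-α : ∀ {g a k} → At r a g → w k ≡ αf (w a) → At r k g
  At-α {g} Aa wk≡αwa = subst (SameEdge g) (sym wk≡αwa) (SameEdge-α Aa)

  module TreeEdge {g a b} (g∈S : InS g) (a<b : a < b) (b<n : b < n) (Aa : At r a g) (Ab : At r b g) where

    a<n : a < n
    a<n = <-trans a<b b<n

    opened : List (Fin n)
    opened = w a ∷ stack a

    position-of-αwa : ∀ {k} → k < n → w k ≡ αf (w a) → k ≡ a ⊎ k ≡ b
    position-of-αwa {k} k<n wk≡αwa = occurrences a<b b<n k<n Aa Ab (At-α {a = a} {k} Aa wk≡αwa)

    pushed-at-a : stack (suc a) ≡ opened
    pushed-at-a with stepAt a
    ... | skip wa∉S _     = contradiction (trans (sym (InS-SameEdge g∈S Aa)) wa∉S) λ ()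
    ... | push _ _ pushes = pushes
    ... | pop {y} _ pops wa≡αy with pushed-earlier a pops
    ...   | k , k<a , wk≡y , _ with position-of-αwa (<-trans k<a a<n) (trans wk≡y (sym (α-flip wa≡αy)))
    ...     | inj₁ k≡a = contradiction k≡a (<⇒≢ k<a)
    ...     | inj₂ k≡b = contradiction k≡b (<⇒≢ (<-trans k<a a<b))

    open-inside : ∀ m → a < m → m ≤ b → opened ≼ stack m
    open-inside m a<m m≤b with opened ≼? stack m
    ... | yes s = s
    ... | no ¬s with popped-between a<m (subst (opened ≼_) (sym pushed-at-a) ≼-refl) ¬s
    ...   | k , a<k , k<m , wk≡αwa , _ with position-of-αwa (<-≤-trans k<m (≤-trans m≤b (<⇒≤ b<n))) wk≡αwa
    ...     | inj₁ k≡a = contradiction (sym k≡a) (<⇒≢ a<k)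
    ...     | inj₂ k≡b = contradiction k≡b (<⇒≢ (<-≤-trans k<m m≤b))

    stack-at-b : stack b ≡ opened
    stack-at-b with open-inside b a<b ≤-refl
    ... | []     , eq = eq
    ... | y ∷ ds , eq with subst (λ L → RootPathTo L (w b)) eq (stack-rooted b)
    ...   | (_ , _ , _ , fresh) , αy∼wb = contradiction (++-vertices ds opened αwa∼αy) fresh
      where
      αwa∼αy : αf (w a) ∼ αf y
      αwa∼αy = subst (_∼ αf y) (second-occurrence a<b b<n Aa Ab) (∼-sym αy∼wb)

    closed-at-b : stack (suc b) ≡ stack a
    closed-at-b with stepAt b
    ... | skip wb∉S _ = contradiction (trans (sym (InS-SameEdge g∈S Ab)) wb∉S) λ ()
    ... | push _ np _ = contradiction (second-occurrence a<b b<n Aa Ab) (np stack-at-b)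
    ... | pop _ pops _ = sym (List.∷-injectiveʳ (trans (sym stack-at-b) pops))

    closed-after : ∀ m → b < m → m ≤ n → ¬ (opened ≼ stack m)
    closed-after m b<m m≤n s
      with pushed-between b<m (subst (λ L → ¬ (opened ≼ L)) (sym closed-at-b) (∷⋠self (w a) (stack a))) s
    ... | k , b<k , k<m , wk≡wa , _ =
          contradiction (w-injective (<-≤-trans k<m m≤n) a<n wk≡wa) (<⇒≢ (<-trans a<b b<k) ∘ sym)

    closed-before : ∀ m → m ≤ a → ¬ (opened ≼ stack m)
    closed-before m m≤a s with popped-between m≤a s (∷⋠self (w a) (stack a))
    ... | k , _ , k<a , wk≡αwa , _ with position-of-αwa (<-trans k<a a<n) wk≡αwa
    ...   | inj₁ k≡a = contradiction k≡a (<⇒≢ k<a)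
    ...   | inj₂ k≡b = contradiction k≡b (<⇒≢ (<-trans k<a a<b))

  occurrence-pair : ∀ {g a b c d} → a < b → b < n → c < d → d < n
                  → At r a g → At r b g → At r c g → At r d g → c ≡ a × d ≡ b
  occurrence-pair a<b b<n c<d d<n Aa Ab Ac Ad
    with occurrences a<b b<n (<-trans c<d d<n) Aa Ab Ac | occurrences a<b b<n d<n Aa Ab Ad
  ... | inj₁ c≡a    | inj₂ d≡b    = c≡a , d≡b
  ... | inj₁ refl   | inj₁ refl   = contradiction refl (<⇒≢ c<d)
  ... | inj₂ refl   | inj₂ refl   = contradiction refl (<⇒≢ c<d)
  ... | inj₂ refl   | inj₁ refl   = contradiction (<-trans a<b c<d) (<-irrefl refl)

  tremaux⇒¬inOut : Tremaux r → ¬ HasInOutS r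
  tremaux⇒¬inOut tremaux
    (f , e₁ , e₂ , e₁∈S , e₂∈S , (i , j , k , l , i<j , j<k , k<l , l<n , Ai , Aj , Ak , Al)
                               , (i′ , j′ , k′ , l′ , i′<j′ , j′<k′ , k′<l′ , l′<n , Ai′ , Aj′ , Ak′ , Al′))
    with occurrence-pair (<-trans j<k k<l) l<n (<-trans i′<j′ j′<k′) (<-trans k′<l′ l′<n) Aj Al Ai′ Ak′
  ... | refl , refl with tremaux (w j) | second-occurrence (<-trans j<k k<l) l<n Aj Al
  ...   | inj₁ wj-above | wl≡αwj = E₁.closed-after l k<l (<⇒≤ l<n)
            (≼-trans (E₁.open-inside j i<j (<⇒≤ j<k))
                     (ancestor⇒≼ j l (subst (Ancestor r (w j)) (sym wl≡αwj) wj-above)))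
    where module E₁ = TreeEdge e₁∈S (<-trans i<j j<k) (<-trans k<l l<n) Ai Ak
  ...   | inj₂ αwj-above | wl≡αwj = E₂.closed-before j (<⇒≤ i′<j′)
            (≼-trans (E₂.open-inside l j′<k′ (<⇒≤ k′<l′))
                     (ancestor⇒≼ l j (subst (λ x → Ancestor r x (w j)) (sym wl≡αwj) αwj-above)))
    where module E₂ = TreeEdge e₂∈S (<-trans j′<k′ k′<l′) l′<n Aj′ Al′

  diverging⇒pattern : ∀ {m₁ m₂} → m₁ < m₂ → m₂ < n → w m₂ ≡ αf (w m₁)
                    → Diverge (stack m₁) (stack m₂) → HasPattern r
  diverging⇒pattern {m₁} {m₂} m₁<m₂ m₂<n w₂≡αw₁ (c , e₁ , e₂ , e₁≢e₂ , s₁ , s₂)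
    with pushed-between z≤n ∷⋠[] s₁
  ... | a₁ , _ , a₁<m₁ , wa₁≡e₁ , _ , _ , e₁∈S
    with popped-between (<⇒≤ m₁<m₂) s₁ (λ s → e₁≢e₂ (≼-head-unique s s₂))
  ... | k₁ , m₁≤k₁ , k₁<m₂ , wk₁≡αe₁ , _ , popped₁
    with pushed-between k₁<m₂ (subst (λ L → ¬ (e₂ ∷ c ≼ L)) (sym popped₁) (∷⋠self e₂ c)) s₂
  ... | a₂ , k₁<a₂ , a₂<m₂ , wa₂≡e₂ , _ , _ , e₂∈S
    with popped-between (<⇒≤ m₂<n) s₂ (subst (λ L → ¬ (e₂ ∷ c ≼ L)) (sym stack-n) ∷⋠[])
  ... | k₂ , m₂≤k₂ , k₂<n , wk₂≡αe₂ , _ =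
    e₁ , w m₁ , e₂ , a₁ , m₁ , k₁ , a₂ , m₂ , k₂ , e₁∈S , e₂∈S
    , a₁<m₁ , m₁<k₁ , k₁<a₂ , a₂<m₂ , m₂<k₂ , k₂<n
    , inj₁ wa₁≡e₁ , inj₁ refl , inj₂ wk₁≡αe₁ , inj₁ wa₂≡e₂ , inj₂ w₂≡αw₁ , inj₂ wk₂≡αe₂
    where
    m₁<k₁ : m₁ < k₁
    m₁<k₁ = ≤∧≢⇒< m₁≤k₁ λ { refl → <⇒≢ (<-trans a₁<m₁ m₁<m₂)
      (w-injective (<-trans (<-trans a₁<m₁ m₁<m₂) m₂<n) m₂<n
        (trans wa₁≡e₁ (sym (trans w₂≡αw₁ (α-flip wk₁≡αe₁))))) }
    m₂<k₂ : m₂ < k₂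
    m₂<k₂ = ≤∧≢⇒< m₂≤k₂ λ { refl → <⇒≢ (≤-<-trans m₁≤k₁ k₁<a₂)
      (w-injective (<-trans m₁<m₂ m₂<n) (<-trans a₂<m₂ m₂<n)
        (trans (sym (α-flip w₂≡αw₁)) (trans (α-flip wk₂≡αe₂) (sym wa₂≡e₂)))) }

  ¬pattern⇒comparable : ¬ HasPattern r → ∀ {m₁ m₂} → m₁ < m₂ → m₂ < n → w m₂ ≡ αf (w m₁)
                      → Ancestor r (w m₁) (w m₂) ⊎ Ancestor r (w m₂) (w m₁)
  ¬pattern⇒comparable no-pattern {m₁} {m₂} m₁<m₂ m₂<n w₂≡αw₁ with ≼-trichotomy (stack m₁) (stack m₂)
  ... | inj₁ s₁₂        = inj₁ (≼⇒ancestor m₁ m₂ s₁₂)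
  ... | inj₂ (inj₁ s₂₁) = inj₂ (≼⇒ancestor m₂ m₁ s₂₁)
  ... | inj₂ (inj₂ div) = contradiction (diverging⇒pattern m₁<m₂ m₂<n w₂≡αw₁ div) no-pattern

  ¬pattern⇒tremaux : ¬ HasPattern r → Tremaux r
  ¬pattern⇒tremaux no-pattern b with position b | position (αf b)
  ... | m₁ , m₁<n , refl | m₂ , m₂<n , w₂≡αw₁ with <-cmp m₁ m₂
  ...   | tri< m₁<m₂ _ _ = subst (λ x → Ancestor r (w m₁) x ⊎ Ancestor r x (w m₁)) w₂≡αw₁
                                 (¬pattern⇒comparable no-pattern m₁<m₂ m₂<n w₂≡αw₁)
  ...   | tri≈ _ refl _  = contradiction (sym w₂≡αw₁) (α-fpf (w m₁))
  ...   | tri> _ _ m₂<m₁ = subst (λ x → Ancestor r (w m₁) x ⊎ Ancestor r x (w m₁)) w₂≡αw₁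
                                 (swap (¬pattern⇒comparable no-pattern m₂<m₁ m₁<n w₁≡αw₂))
    where
    w₁≡αw₂ : w m₁ ≡ αf (w m₂)
    w₁≡αw₂ = sym (α-flip w₂≡αw₁)

pattern⇒inOut : ∀ {n} (M : Map n) S r
              → MapNotions.InSubgraph.HasPattern M S r → MapNotions.InSubgraph.HasInOutS M S r
pattern⇒inOut M S r (e₁ , f , e₂ , i₁ , i₂ , i₃ , i₄ , i₅ , i₆ , e₁∈S , e₂∈S
                    , i₁<i₂ , i₂<i₃ , i₃<i₄ , i₄<i₅ , i₅<i₆ , i₆<n , A₁ , A₂ , A₃ , A₄ , A₅ , A₆) =
  f , e₁ , e₂ , e₁∈S , e₂∈S
  , (i₁ , i₂ , i₃ , i₅ , i₁<i₂ , i₂<i₃ , <-trans i₃<i₄ i₄<i₅ , <-trans i₅<i₆ i₆<n , A₁ , A₂ , A₃ , A₅)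
  , (i₂ , i₄ , i₅ , i₆ , <-trans i₂<i₃ i₃<i₄ , i₄<i₅ , i₅<i₆ , i₆<n , A₂ , A₄ , A₅ , A₆)

lemma14 : ∀ {n : ℕ} (M : Map n) (b• : Fin n) (S : Fin n → Bool)
    → MapNotions.InSubgraph.IsSpanningTree M S
    → (MapNotions.InSubgraph.Tremaux M S b• ⇔ (¬ MapNotions.InSubgraph.HasInOutS M S b•))
      × (MapNotions.InSubgraph.Tremaux M S b• ⇔ (¬ MapNotions.InSubgraph.HasPattern M S b•))
lemma14 M b• S tree =
    mk⇔ tremaux⇒¬inOut (λ ¬inOut → ¬pattern⇒tremaux (¬inOut ∘ pattern⇒inOut M S b•))
  , mk⇔ (λ tremaux → tremaux⇒¬inOut tremaux ∘ pattern⇒inOut M S b•) ¬pattern⇒tremaux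
  where open TourStack M S tree b•
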